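{- Let $O=\{o_1,\ldots,o_k\}$ be a finite set equipped with a linear order $\succ$, and let $\mathcal{A}=\{A_1,\ldots,A_m\}$ and $\mathcal{B}=\{B_1,\ldots,B_n\}$ be dual multi-hypergraphs on the ground set $O$. Let $A^0\in\mathcal{A}$ be a lexmax edge of $\mathcal{A}$, i.e. an edge such that $A^0\succeq_L A$ for every $A\in\mathcal{A}$. Then $A^0$ is a minimal edge of $\mathcal{A}$. Furthermore, for every $o^0\in A^0$ there exists a minimal edge $B^0\in\mathcal{B}$ such that $A^0\cap B^0=\{o^0\}$ and $o^0\succeq o$ for each $o\in B^0$.
   Context: A multi-hypergraph on $O$ is a finite list of subsets of $O$ (its edges), where equal edges and edges contained in one another are allowed. An edge is (containment) minimal if it is not a strict superset of another edge of the same multi-hypergraph. Multi-hypergraphs $\mathcal{A}$ and $\mathcal{B}$ on $O$ are dual if (i) $A\cap B\neq\emptyset$ for every $A\in\mathcal{A}$ and $B\in\mathcal{B}$, and (ii) for every $B^T\subseteq O$ with $B^T\cap B\neq\emptyset$ for all $B\in\mathcal{B}$, there exists $A\in\mathcal{A}$ with $A\subseteq B^T$. The lexicographic order $\succ_L$ on $2^O$ induced by $\succ$ is defined as follows: for distinct $O',O''\subseteq O$, let $o$ be the $\succ$-minimum element of the symmetric difference $(O'\setminus O'')\cup(O''\setminus O')$; if $o\in O'\setminus O''$ then $O''\succ_L O'$, and if $o\in O''\setminus O'$ then $O'\succ_L O''$. (Equivalently, if $o_1\prec\cdots\prec o_k$ and $w(o_i)=-2^{k-i}$, $w(U)=\sum_{o\in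 U}w(o)$, then $O'\succ_L O''$ iff $w(O')>w(O'')$.) -}

module Defs where

open import Data.Nat using (ℕ)
open import Data.Fin using (Fin)
open import Data.Fin.Subset using (Subset; _∈_; _∉_; _⊆_; _⊂_; _∩_; Nonempty)
open import Data.List using (List)
open import Data.List.Membership.Propositional as L using ()
open import Data.Product using (Σ; _×_; ∃)
open import Data.Sum using (_⊎_)
open import Function.Bundles using (_⇔_)
open import Relation.Nullary using (¬_)
open import Relation.Binary.PropositionalEquality using (_≡_)

MultiHypergraph : ℕ → Set
MultiHypergraph k = List (Subset k)

IsMinimalEdge : ∀ {k} → MultiHypergraph k → Subset k → Set
IsMinimalEdge H E = E L.∈ H × (∀ E' → E' L.∈ H → ¬ (E' ⊂ E))

Dual : ∀ {k} → MultiHypergraph k → MultiHypergraph k → Set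
Dual {k} 𝒜 ℬ =
  (∀ A B → A L.∈ 𝒜 → B L.∈ ℬ → Nonempty (A ∩ B))
  × (∀ (BT : Subset k) → (∀ B → B L.∈ ℬ → Nonempty (BT ∩ B))
       → Σ (Subset k) λ A → A L.∈ 𝒜 × A ⊆ BT)

-- Lexicographic order induced by a strict order _≺_ on Fin k
-- (o ≺ o' means o' ≻ o).  O' ≻_L O'' iff the ≺-minimum o of the symmetric
-- difference lies in O'' ∖ O'.  Stated directly: there is o ∈ O'' ∖ O'
-- such that no element ≺ o lies in the symmetric difference.
LexGt : ∀ {k} → (Fin k → Fin k → Set) → Subset k → Subset k → Set
LexGt {k} _≺_ O' O'' =
  Σ (Fin k) λ o → o ∈ O'' × o ∉ O' × (∀ o' → o' ≺ o → (o' ∈ O' ⇔ o' ∈ O''))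

LexGe : ∀ {k} → (Fin k → Fin k → Set) → Subset k → Subset k → Set
LexGe _≺_ O' O'' = O' ≡ O'' ⊎ LexGt _≺_ O' O''

-- A strict subset of the lexmax edge A⁰ would be lexicographically larger, so A⁰ is minimal.
-- For o⁰ ∈ A⁰ let T consist of all elements except o⁰ and the o ≺ o⁰ outside A⁰. An edge of 𝒜
-- inside T misses o⁰ ∈ A⁰, so as A⁰ is lexmax it contains some o ≺ o⁰ outside A⁰, which T
-- excludes. Hence T is not a transversal of ℬ, and a minimal edge B⁰ inside an edge missing T
-- meets A⁰ only in o⁰ (it meets A⁰ at all by duality) and has no element above o⁰.
module Submission where

open import Defs
open import Data.Nat using (ℕ)
open import Data.Bool using (if_then_else_)
open import Data.Fin using (Fin; _≟_)
open import Data.Fin.Subset using (Subset; _∈_; _∉_; _⊆_; _⊂_; _∩_; ⁅_⁆; Nonempty; inside; outside)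
open import Data.Fin.Subset.Properties
  using (_∈?_; _⊂?_; ⊆-antisym; ⊂-irref; x∈p∩q⁺; x∈p∩q⁻; x∈⁅x⁆; x∈⁅y⁆⇒x≡y)
open import Data.Fin.Subset.Induction using (Acc; acc; ⊂-wellFounded)
open import Data.Fin.Properties using (all?; ¬∀⟶∃¬)
open import Data.List.Membership.Propositional as L using ()
open import Data.List.Relation.Unary.Any using (Any; any?)
open import Data.Product using (Σ; _×_; _,_; proj₁; ∃)
open import Data.Sum using (_⊎_; inj₁; inj₂)
open import Data.Vec using (tabulate)
open import Data.Vec.Properties using (lookup⇒[]=; []=⇒lookup; lookup∘tabulate)
open import Data.Empty using (⊥-elim)
open import Function using (_∘_)
open import Level using (0ℓ)
open import Function.Bundles using (Equivalence)
open import Relation.Nullary using (¬_; yes; no; does; _×-dec_; _⊎-dec_; ¬?; _→-dec_)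
open import Relation.Nullary.Decidable using (dec-true)
open import Relation.Unary using (Pred; Decidable)
open import Relation.Binary.Structures using (IsStrictTotalOrder)
open import Relation.Binary.Definitions using (Trichotomous; tri<; tri≈; tri>)
open import Relation.Binary.Consequences using (tri⇒dec<)
open import Relation.Binary.PropositionalEquality using (_≡_; refl; sym; trans; cong)

fromDec : ∀ {k} {P : Pred (Fin k) 0ℓ} → Decidable P → Subset k
fromDec P? = tabulate (λ o → if does (P? o) then inside else outside)

module _ {k} {P : Pred (Fin k) 0ℓ} (P? : Decidable P) where

  ∈-fromDec⁺ : ∀ {o} → P o → o ∈ fromDec P?
  ∈-fromDec⁺ {o} p = lookup⇒[]= o (fromDec P?)
    (trans (lookup∘tabulate _ o) (cong (if_then inside else outside) (dec-true (P? o) p)))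

  ∈-fromDec⁻ : ∀ {o} → o ∈ fromDec P? → P o
  ∈-fromDec⁻ {o} o∈ with P? o | trans (sym (lookup∘tabulate _ o)) ([]=⇒lookup o∈)
  ... | yes p | _ = p
  ... | no _  | ()

nonempty-⊆⁅x⁆⇒≡⁅x⁆ : ∀ {k} {p : Subset k} {x} → Nonempty p → p ⊆ ⁅ x ⁆ → p ≡ ⁅ x ⁆
nonempty-⊆⁅x⁆⇒≡⁅x⁆ {x = x} (y , y∈p) p⊆⁅x⁆ = ⊆-antisym p⊆⁅x⁆ ⁅x⁆⊆p
  where
  ⁅x⁆⊆p : ⁅ x ⁆ ⊆ _
  ⁅x⁆⊆p z∈⁅x⁆ with x∈⁅y⁆⇒x≡y x z∈⁅x⁆ | x∈⁅y⁆⇒x≡y x (p⊆⁅x⁆ y∈p)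
  ... | refl | refl = y∈p

minimalEdge-⊆ : ∀ {k} (H : MultiHypergraph k) {E} → E L.∈ H
  → Σ (Subset k) λ E⁰ → IsMinimalEdge H E⁰ × E⁰ ⊆ E
minimalEdge-⊆ H {E} E∈H = descend E (⊂-wellFounded E) E∈H
  where
  descend : ∀ E → Acc _⊂_ E → E L.∈ H → Σ (Subset _) λ E⁰ → IsMinimalEdge H E⁰ × E⁰ ⊆ E
  descend E (acc smaller) E∈H with any? (_⊂? E) H
  ... | no ∄E'⊂E = E , (E∈H , λ E' E'∈H E'⊂E → ∄E'⊂E (L.lose E'∈H E'⊂E)) , λ o∈E → o∈E
  ... | yes ∃E'⊂E with L.find ∃E'⊂E
  ... | E' , E'∈H , E'⊂E with descend E' (smaller E'⊂E) E'∈H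
  ... | E⁰ , E⁰-min , E⁰⊆E' = E⁰ , E⁰-min , proj₁ E'⊂E ∘ E⁰⊆E'

∄edge⊆⇒∁-transversal : ∀ {k} {ℬ : MultiHypergraph k} {P : Pred (Fin k) 0ℓ} (P? : Decidable P)
  → ¬ Any (λ B → ∀ o → o ∈ B → P o) ℬ → ∀ B → B L.∈ ℬ → Nonempty (fromDec (¬? ∘ P?) ∩ B)
∄edge⊆⇒∁-transversal {k} P? ∄B⊆P B B∈ℬ
  with ¬∀⟶∃¬ k _ (λ o → o ∈? B →-dec P? o) (∄B⊆P ∘ L.lose B∈ℬ)
... | o , ¬[o∈B→Po] with o ∈? B
... | yes o∈B = o , x∈p∩q⁺ (∈-fromDec⁺ (¬? ∘ P?) (λ Po → ¬[o∈B→Po] (λ _ → Po)) , o∈B)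
... | no o∉B = ⊥-elim (¬[o∈B→Po] (⊥-elim ∘ o∉B))

dual⇒edge⊆⊎edge-avoids : ∀ {k} {𝒜 ℬ : MultiHypergraph k} → Dual 𝒜 ℬ
  → {P : Pred (Fin k) 0ℓ} → Decidable P
  → (∃ λ B → B L.∈ ℬ × (∀ o → o ∈ B → P o)) ⊎ (∃ λ A → A L.∈ 𝒜 × (∀ o → o ∈ A → ¬ P o))
dual⇒edge⊆⊎edge-avoids {ℬ = ℬ} (_ , transversal⇒edge) P?
  with any? (λ B → all? (λ o → o ∈? B →-dec P? o)) ℬ
... | yes ∃B⊆P = inj₁ (L.find ∃B⊆P)
... | no ∄B⊆P with transversal⇒edge (fromDec (¬? ∘ P?)) (∄edge⊆⇒∁-transversal P? ∄B⊆P)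
... | A , A∈𝒜 , A⊆∁P = inj₂ (A , A∈𝒜 , λ o → ∈-fromDec⁻ (¬? ∘ P?) ∘ A⊆∁P)

lexGe⇒¬⊂ : ∀ {k} {_≺_ : Fin k → Fin k → Set} {A⁰ A} → LexGe _≺_ A⁰ A → ¬ A ⊂ A⁰
lexGe⇒¬⊂ (inj₁ refl) A⊂A⁰ = ⊂-irref refl A⊂A⁰
lexGe⇒¬⊂ (inj₂ (o , o∈A , o∉A⁰ , _)) (A⊆A⁰ , _) = o∉A⁰ (A⊆A⁰ o∈A)

module _ {k} {_≺_ : Fin k → Fin k → Set} (compare : Trichotomous _≡_ _≺_) where

  lexGe-∈∖∉⇒smaller : ∀ {A⁰ A o⁰} → LexGe _≺_ A⁰ A → o⁰ ∈ A⁰ → o⁰ ∉ A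
    → ∃ λ o → o ≺ o⁰ × o ∈ A × o ∉ A⁰
  lexGe-∈∖∉⇒smaller (inj₁ refl) o⁰∈A⁰ o⁰∉A = ⊥-elim (o⁰∉A o⁰∈A⁰)
  lexGe-∈∖∉⇒smaller {o⁰ = o⁰} (inj₂ (o , o∈A , o∉A⁰ , agree)) o⁰∈A⁰ o⁰∉A with compare o o⁰
  ... | tri< o≺o⁰ _ _ = o , o≺o⁰ , o∈A , o∉A⁰
  ... | tri≈ _ refl _ = ⊥-elim (o∉A⁰ o⁰∈A⁰)
  ... | tri> _ _ o⁰≺o = ⊥-elim (o⁰∉A (Equivalence.to (agree o⁰ o⁰≺o) o⁰∈A⁰))

  Admissible : Subset k → Fin k → Pred (Fin k) 0ℓ
  Admissible A⁰ o⁰ o = o ≡ o⁰ ⊎ (o ∉ A⁰ × o ≺ o⁰)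

  admissible? : ∀ A⁰ o⁰ → Decidable (Admissible A⁰ o⁰)
  admissible? A⁰ o⁰ o = o ≟ o⁰ ⊎-dec (¬? (o ∈? A⁰) ×-dec tri⇒dec< compare o o⁰)

  lexMax⇒admissibleEdge : ∀ {𝒜 ℬ : MultiHypergraph k} → Dual 𝒜 ℬ
    → ∀ {A⁰} → (∀ A → A L.∈ 𝒜 → LexGe _≺_ A⁰ A)
    → ∀ {o⁰} → o⁰ ∈ A⁰ → ∃ λ B → B L.∈ ℬ × (∀ o → o ∈ B → Admissible A⁰ o⁰ o)
  lexMax⇒admissibleEdge dual {A⁰} lexMax {o⁰} o⁰∈A⁰
    with dual⇒edge⊆⊎edge-avoids dual (admissible? A⁰ o⁰)
  ... | inj₁ B-admissible = B-admissible
  ... | inj₂ (A , A∈𝒜 , A-inadmissible)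
    with lexGe-∈∖∉⇒smaller (lexMax A A∈𝒜) o⁰∈A⁰ (λ o⁰∈A → A-inadmissible o⁰ o⁰∈A (inj₁ refl))
  ... | o , o≺o⁰ , o∈A , o∉A⁰ = ⊥-elim (A-inadmissible o o∈A (inj₂ (o∉A⁰ , o≺o⁰)))

theorem1 : (k : ℕ) (_≺_ : Fin k → Fin k → Set) → IsStrictTotalOrder _≡_ _≺_
    → (𝒜 ℬ : MultiHypergraph k) → Dual 𝒜 ℬ
    → (A⁰ : Subset k) → A⁰ L.∈ 𝒜 → (∀ A → A L.∈ 𝒜 → LexGe _≺_ A⁰ A)
    → IsMinimalEdge 𝒜 A⁰
      × (∀ o⁰ → o⁰ ∈ A⁰ → Σ (Subset k) λ B⁰ →
           IsMinimalEdge ℬ B⁰ × (A⁰ ∩ B⁰ ≡ ⁅ o⁰ ⁆)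
           × (∀ o → o ∈ B⁰ → o ≡ o⁰ ⊎ o ≺ o⁰))
theorem1 k _≺_ sto 𝒜 ℬ dual@(meets , _) A⁰ A⁰∈𝒜 lexMax =
  (A⁰∈𝒜 , λ A A∈𝒜 → lexGe⇒¬⊂ (lexMax A A∈𝒜)) , minimalAdmissibleEdge
  where
  open IsStrictTotalOrder sto using (compare)

  minimalAdmissibleEdge : ∀ o⁰ → o⁰ ∈ A⁰ → Σ (Subset k) λ B⁰ →
    IsMinimalEdge ℬ B⁰ × (A⁰ ∩ B⁰ ≡ ⁅ o⁰ ⁆) × (∀ o → o ∈ B⁰ → o ≡ o⁰ ⊎ o ≺ o⁰)
  minimalAdmissibleEdge o⁰ o⁰∈A⁰ with lexMax⇒admissibleEdge compare dual lexMax o⁰∈A⁰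
  ... | B , B∈ℬ , B-admissible with minimalEdge-⊆ ℬ B∈ℬ
  ... | B⁰ , B⁰-min@(B⁰∈ℬ , _) , B⁰⊆B =
    B⁰ , B⁰-min , nonempty-⊆⁅x⁆⇒≡⁅x⁆ (meets A⁰ B⁰ A⁰∈𝒜 B⁰∈ℬ) A⁰∩B⁰⊆⁅o⁰⁆ , ≤o⁰
    where
    A⁰∩B⁰⊆⁅o⁰⁆ : A⁰ ∩ B⁰ ⊆ ⁅ o⁰ ⁆
    A⁰∩B⁰⊆⁅o⁰⁆ o∈A⁰∩B⁰ with x∈p∩q⁻ A⁰ B⁰ o∈A⁰∩B⁰
    ... | o∈A⁰ , o∈B⁰ with B-admissible _ (B⁰⊆B o∈B⁰)
    ... | inj₁ refl = x∈⁅x⁆ o⁰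
    ... | inj₂ (o∉A⁰ , _) = ⊥-elim (o∉A⁰ o∈A⁰)

    ≤o⁰ : ∀ o → o ∈ B⁰ → o ≡ o⁰ ⊎ o ≺ o⁰
    ≤o⁰ o o∈B⁰ with B-admissible o (B⁰⊆B o∈B⁰)
    ... | inj₁ o≡o⁰ = inj₁ o≡o⁰
    ... | inj₂ (_ , o≺o⁰) = inj₂ o≺o⁰
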